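{- Let $D$ be a $k$-fold circuit in a matroid $\mathcal{M}=(E,r)$ with closure operator $\mathrm{cl}$, and let $\{A_1,\dots,A_\ell\}$ be the principal partition of $D$. Then \[ r\Big(\bigcap_{i=1}^\ell \mathrm{cl}(D\setminus A_i)\Big)\leq \ell-k. \] Moreover, equality holds if and only if, for every $2\leq n\leq \ell$, the flats $\bigcap_{i=1}^{n-1}\mathrm{cl}(D\setminus A_i)$ and $\mathrm{cl}(D\setminus A_n)$ form a modular pair of flats of $\mathcal{M}$.
   Context: Matroids have finite ground sets. A cyclic set of $\mathcal{M}=(E,r)$ is a set $D\subseteq E$ with $r(D-e)=r(D)$ for all $e\in D$ (equivalently a union of circuits). A $k$-fold circuit is a cyclic set $D$ with $r(D)=|D|-k$. The closure is $\mathrm{cl}(X)=\{x\in E: r(X+x)=r(X)\}$ and a flat is a set $F$ with $\mathrm{cl}(F)=F$. The principal partition of a $k$-fold circuit $D$ is the collection $\{D\setminus B: B\subseteq D \text{ is a } (k-1)\text{ -fold circuit of } \mathcal{M}\}$ (it is a partition of $D$). Two flats $X,Y$ form a modular pair if $r(X)+r(Y)=r(\mathrm{cl}(X\cup Y))+r(X\cap Y)$. -}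

module Defs where

open import Data.Nat using (ℕ; suc; _+_; _∸_; _≤_; _≟_)
open import Data.Fin using (Fin; toℕ)
open import Data.Fin.Subset using (Subset; _∪_; _∩_; _─_; _-_; ⁅_⁆; ⋂; _⊆_; _∈_; ∣_∣)
open import Data.List using (map; take; allFin)
open import Data.Vec using (tabulate)
open import Data.Product using (Σ; ∃; _×_)
open import Relation.Nullary.Decidable using (does)
open import Relation.Binary.PropositionalEquality using (_≡_)

record Matroid (n : ℕ) : Set where
  field
    r         : Subset n → ℕ
    r-bounded : ∀ X → r X ≤ ∣ X ∣
    r-mono    : ∀ {X Y} → X ⊆ Y → r X ≤ r Y
    r-submod  : ∀ X Y → r (X ∪ Y) + r (X ∩ Y) ≤ r X + r Y

module _ {n : ℕ} (M : Matroid n) where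
  open Matroid M

  cl : Subset n → Subset n
  cl X = tabulate (λ x → does (r (X ∪ ⁅ x ⁆) ≟ r X))

  IsFlat : Subset n → Set
  IsFlat F = cl F ≡ F

  IsCyclic : Subset n → Set
  IsCyclic D = ∀ e → e ∈ D → r (D - e) ≡ r D

  -- k-fold circuit: cyclic with r D = |D| - k  (stated as r D + k = |D|)
  IsKFoldCircuit : ℕ → Subset n → Set
  IsKFoldCircuit k D = IsCyclic D × (r D + k ≡ ∣ D ∣)

  InPrincipalPartition : ℕ → Subset n → Subset n → Set
  InPrincipalPartition k D X =
    ∃ λ B → B ⊆ D × IsKFoldCircuit (k ∸ 1) B × X ≡ D ─ B

  IsModularPair : Subset n → Subset n → Set
  IsModularPair X Y =
    IsFlat X × IsFlat Y × (r X + r Y ≡ r (cl (X ∪ Y)) + r (X ∩ Y))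

  -- ⋂_{i < m} cl (D \ A i)  (0-based; empty intersection = E)
  prefixInter : {ℓ : ℕ} → Subset n → (Fin ℓ → Subset n) → ℕ → Subset n
  prefixInter {ℓ} D A m = ⋂ (map (λ i → cl (D ─ A i)) (take m (allFin ℓ)))

{-# OPTIONS --safe #-}
module Submission where

-- Write ν X = ∣ X ∣ ∸ r X for the nullity; it is supermodular, and a cyclic set has strictly larger
-- nullity than each of its proper subsets.  The complements C i = D ─ A i of the blocks are the
-- (k-1)-fold circuits inside D.  Supermodularity shows that two of them avoiding a common element of D
-- coincide, and deleting coloops from D - x produces one that avoids x; so the blocks partition D.
-- Let F m = ⋂_{i<m} cl (C i) and G m = D ∩ ⋂_{i<m} C i.  For m ≥ 1, G m ∪ C m = D and
-- D ⊆ F m ∪ cl (C m) ⊆ cl D, so submodularity of r on F m, cl (C m) and the identity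
-- ∣ G m ∣ + ∣ C m ∣ = ∣ D ∣ + ∣ G (m + 1) ∣ give by induction
--   r (F m) + k + (sum of the modular defects of the pairs 1, …, m - 1) = m + ∣ G m ∣.
-- Finally G ℓ = ∅, so r (F ℓ) + k ≤ ℓ, with equality iff every defect vanishes.

open import Defs
open import Data.Nat using (ℕ; zero; suc; pred; _+_; _∸_; _≤_; _<_; z≤n; s≤s; s≤s⁻¹; s<s⁻¹)
open import Data.Nat.Properties
open import Data.Nat.Tactic.RingSolver using (solve)
open import Algebra.Properties.CommutativeSemigroup +-commutativeSemigroup using (interchange)
open import Data.Fin using (Fin; toℕ; fromℕ<)
import Data.Fin as Fin
open import Data.Fin.Properties
  using (toℕ-fromℕ<; toℕ-injective; toℕ<n; all?; ¬∀⟶∃¬; nonZeroIndex) renaming (_≟_ to _≟ᶠ_)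
open import Data.Fin.Subset
open import Data.Fin.Subset.Properties
open import Data.Fin.Subset.Induction using (⊂-wellFounded)
open import Data.List using (List; []; _∷_; map; take; allFin; tabulate)
open import Data.Vec.Properties using (lookup∘tabulate; []=⇒lookup; lookup⇒[]=)
open import Data.Product using (Σ-syntax; ∃; _×_; _,_; proj₁; proj₂)
open import Data.Sum using (_⊎_; inj₁; inj₂)
open import Function using (id; _∘_; _⇔_; mk⇔; Equivalence)
open import Function.Construct.Composition using (_⇔-∘_)
open import Function.Construct.Symmetry using (⇔-sym)
open import Data.Product.Function.NonDependent.Propositional using (_×-⇔_)
open import Function.Definitions using (Injective)
open import Induction.WellFounded using (Acc; acc)
open import Relation.Binary.PropositionalEquality
open import Relation.Nullary using (Dec; yes; no; proof; contradiction)
open import Relation.Nullary.Reflects using (Reflects; invert)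
open import Relation.Nullary.Decidable using (dec-true; _→-dec_)

private
  variable
    n : ℕ
    p q u : Subset n
    x : Fin n

∪-lub : p ⊆ u → q ⊆ u → p ∪ q ⊆ u
∪-lub {p = p} {q = q} p⊆u q⊆u x∈p∪q with x∈p∪q⁻ p q x∈p∪q
... | inj₁ x∈p = p⊆u x∈p
... | inj₂ x∈q = q⊆u x∈q

∩-glb : u ⊆ p → u ⊆ q → u ⊆ p ∩ q
∩-glb u⊆p u⊆q x∈u = x∈p∩q⁺ (u⊆p x∈u , u⊆q x∈u)

-- The vector constructors are kept out of the global scope: overloading _∷_ slows `solve` down badly.
module _ where
  open import Data.Vec using ([]; _∷_; here; there)

  x∈p─q⇒x∉q : x ∈ p ─ q → x ∉ q
  x∈p─q⇒x∉q {p = _ ∷ _}      {q = inside ∷ _}  ()        here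
  x∈p─q⇒x∉q {p = inside ∷ _} {q = outside ∷ _} here      ()
  x∈p─q⇒x∉q {p = _ ∷ _}      {q = _ ∷ _}       (there h) (there h′) = x∈p─q⇒x∉q h h′

  ∣p∪q∣+∣p∩q∣≡∣p∣+∣q∣ : ∀ (p q : Subset n) → ∣ p ∪ q ∣ + ∣ p ∩ q ∣ ≡ ∣ p ∣ + ∣ q ∣
  ∣p∪q∣+∣p∩q∣≡∣p∣+∣q∣ []            []            = refl
  ∣p∪q∣+∣p∩q∣≡∣p∣+∣q∣ (inside ∷ p)  (inside ∷ q)  =
    cong suc (trans (+-suc ∣ p ∪ q ∣ ∣ p ∩ q ∣)
                    (trans (cong suc (∣p∪q∣+∣p∩q∣≡∣p∣+∣q∣ p q)) (sym (+-suc ∣ p ∣ ∣ q ∣))))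
  ∣p∪q∣+∣p∩q∣≡∣p∣+∣q∣ (inside ∷ p)  (outside ∷ q) = cong suc (∣p∪q∣+∣p∩q∣≡∣p∣+∣q∣ p q)
  ∣p∪q∣+∣p∩q∣≡∣p∣+∣q∣ (outside ∷ p) (inside ∷ q)  =
    trans (cong suc (∣p∪q∣+∣p∩q∣≡∣p∣+∣q∣ p q)) (sym (+-suc ∣ p ∣ ∣ q ∣))
  ∣p∪q∣+∣p∩q∣≡∣p∣+∣q∣ (outside ∷ p) (outside ∷ q) = ∣p∪q∣+∣p∩q∣≡∣p∣+∣q∣ p q

  x∈p⇒suc∣p-x∣≡∣p∣ : x ∈ p → suc ∣ p - x ∣ ≡ ∣ p ∣
  x∈p⇒suc∣p-x∣≡∣p∣ {p = inside ∷ p}  here      = cong (suc ∘ ∣_∣) (p─⊥≡p p)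
  x∈p⇒suc∣p-x∣≡∣p∣ {p = inside ∷ _}  (there h) = cong suc (x∈p⇒suc∣p-x∣≡∣p∣ h)
  x∈p⇒suc∣p-x∣≡∣p∣ {p = outside ∷ _} (there h) = x∈p⇒suc∣p-x∣≡∣p∣ h

p─[p─q]≡q : q ⊆ p → p ─ (p ─ q) ≡ q
p─[p─q]≡q {q = q} {p = p} q⊆p =
  ⊆-antisym ⊆q (λ x∈q → x∈p∧x∉q⇒x∈p─q (q⊆p x∈q) (λ x∈p─q → x∈p─q⇒x∉q x∈p─q x∈q))
  where
  ⊆q : p ─ (p ─ q) ⊆ q
  ⊆q {x} h with x ∈? q
  ... | yes x∈q = x∈q
  ... | no x∉q = contradiction (x∈p∧x∉q⇒x∈p─q (p─q⊆p p _ h) x∉q) (x∈p─q⇒x∉q h)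

p∪[q─p]≡q : p ⊆ q → p ∪ (q ─ p) ≡ q
p∪[q─p]≡q {p = p} {q = q} p⊆q = ⊆-antisym (∪-lub p⊆q (p─q⊆p q p)) ⊆p∪
  where
  ⊆p∪ : q ⊆ p ∪ (q ─ p)
  ⊆p∪ {x} x∈q with x ∈? p
  ... | yes x∈p = x∈p∪q⁺ (inj₁ x∈p)
  ... | no x∉p = x∈p∪q⁺ (inj₂ (x∈p∧x∉q⇒x∈p─q x∈q x∉p))

Empty⇒∣p∣≡0 : Empty p → ∣ p ∣ ≡ 0
Empty⇒∣p∣≡0 {n} p-empty = trans (cong ∣_∣ (Empty-unique p-empty)) (∣⊥∣≡0 n)

∣p∩[q─p]∣≡0 : ∀ (p q : Subset n) → ∣ p ∩ (q ─ p) ∣ ≡ 0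
∣p∩[q─p]∣≡0 p q = Empty⇒∣p∣≡0 empty
  where
  empty : Empty (p ∩ (q ─ p))
  empty (x , h) with x∈p∩q⁻ p _ h
  ... | x∈p , x∈q─p = x∈p─q⇒x∉q x∈q─p x∈p

module _ {n : ℕ} (M : Matroid n) where
  open Matroid M

  private
    variable
      X Y Z C D : Subset n
      e : Fin n
      k : ℕ

  -- Closure, flats and modular pairs

  ∈cl⇔ : x ∈ cl M X ⇔ r (X ∪ ⁅ x ⁆) ≡ r X
  ∈cl⇔ {x = x} {X = X} = mk⇔
    (λ x∈cl → invert (subst (Reflects _) (trans (sym (lookup∘tabulate _ x)) ([]=⇒lookup x∈cl))
                                         (proof (r (X ∪ ⁅ x ⁆) ≟ r X))))
    (λ eq → lookup⇒[]= x _ (trans (lookup∘tabulate _ x) (dec-true (r (X ∪ ⁅ x ⁆) ≟ r X) eq)))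

  r-∪⁅⁆≤⇒∈cl : r (X ∪ ⁅ x ⁆) ≤ r X → x ∈ cl M X
  r-∪⁅⁆≤⇒∈cl {X = X} ≤r = Equivalence.from ∈cl⇔ (≤-antisym ≤r (r-mono (p⊆p∪q _)))

  X⊆cl[X] : X ⊆ cl M X
  X⊆cl[X] {X = X} x∈X =
    r-∪⁅⁆≤⇒∈cl (r-mono (∪-lub id (λ y∈⁅x⁆ → subst (_∈ X) (sym (x∈⁅y⁆⇒x≡y _ y∈⁅x⁆)) x∈X)))

  r-∪-≤-lift : X ⊆ Y → r (X ∪ Z) ≤ r X → r (Y ∪ Z) ≤ r Y
  r-∪-≤-lift {X = X} {Y = Y} {Z = Z} X⊆Y XZ≤X = +-cancelʳ-≤ (r X) _ _ (begin
    r (Y ∪ Z) + r X                    ≤⟨ +-mono-≤ (r-mono Y∪Z⊆) (r-mono (∩-glb X⊆Y (p⊆p∪q Z))) ⟩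
    r (Y ∪ (X ∪ Z)) + r (Y ∩ (X ∪ Z))  ≤⟨ r-submod Y (X ∪ Z) ⟩
    r Y + r (X ∪ Z)                    ≤⟨ +-monoʳ-≤ (r Y) XZ≤X ⟩
    r Y + r X                          ∎)
    where
    open ≤-Reasoning
    Y∪Z⊆ : Y ∪ Z ⊆ Y ∪ (X ∪ Z)
    Y∪Z⊆ = ∪-lub (p⊆p∪q _) (q⊆p∪q Y _ ∘ q⊆p∪q X Z)

  r-∪-≤-of-⊆cl : ∀ S → S ⊆ cl M X → r (X ∪ S) ≤ r X
  r-∪-≤-of-⊆cl {X = X} S = go S (⊂-wellFounded S)
    where
    go : ∀ S → Acc _⊂_ S → S ⊆ cl M X → r (X ∪ S) ≤ r X
    go S (acc rec) S⊆cl with nonempty? S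
    ... | no S-empty = r-mono (∪-lub id (λ x∈S → contradiction (_ , x∈S) S-empty))
    ... | yes (x , x∈S) = begin
      r (X ∪ S)                    ≤⟨ r-mono X∪S⊆ ⟩
      r ((X ∪ (S - x)) ∪ ⁅ x ⁆)    ≤⟨ r-∪-≤-lift (p⊆p∪q _) (≤-reflexive (Equivalence.to ∈cl⇔ (S⊆cl x∈S))) ⟩
      r (X ∪ (S - x))              ≤⟨ go (S - x) (rec (x∈p⇒p-x⊂p x∈S)) (S⊆cl ∘ p─q⊆p S _) ⟩
      r X                          ∎
      where
      open ≤-Reasoning
      X∪S⊆ : X ∪ S ⊆ (X ∪ (S - x)) ∪ ⁅ x ⁆
      X∪S⊆ {y} y∈X∪S with x∈p∪q⁻ X S y∈X∪S | y ≟ᶠ x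
      ... | inj₁ y∈X | _        = x∈p∪q⁺ (inj₁ (x∈p∪q⁺ (inj₁ y∈X)))
      ... | inj₂ _   | yes refl = x∈p∪q⁺ (inj₂ (x∈⁅x⁆ x))
      ... | inj₂ y∈S | no y≢x   = x∈p∪q⁺ (inj₁ (x∈p∪q⁺ (inj₂ (x∈p∧x≢y⇒x∈p-y y∈S y≢x))))

  r-cl : r (cl M X) ≡ r X
  r-cl {X = X} = ≤-antisym (≤-trans (r-mono (q⊆p∪q X _)) (r-∪-≤-of-⊆cl (cl M X) id)) (r-mono X⊆cl[X])

  cl-mono : X ⊆ Y → cl M X ⊆ cl M Y
  cl-mono X⊆Y x∈cl = r-∪⁅⁆≤⇒∈cl (r-∪-≤-lift X⊆Y (≤-reflexive (Equivalence.to ∈cl⇔ x∈cl)))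

  cl-isFlat : IsFlat M (cl M X)
  cl-isFlat {X = X} = ⊆-antisym cl²⊆cl X⊆cl[X]
    where
    cl²⊆cl : cl M (cl M X) ⊆ cl M X
    cl²⊆cl {x} x∈cl² = r-∪⁅⁆≤⇒∈cl (begin
      r (X ∪ ⁅ x ⁆)       ≤⟨ r-mono (∪-lub (p⊆p∪q _ ∘ X⊆cl[X]) (q⊆p∪q _ _)) ⟩
      r (cl M X ∪ ⁅ x ⁆)  ≡⟨ Equivalence.to ∈cl⇔ x∈cl² ⟩
      r (cl M X)          ≡⟨ r-cl ⟩
      r X                 ∎)
      where open ≤-Reasoning

  ⊤-isFlat : IsFlat M ⊤
  ⊤-isFlat = ⊆-antisym (λ _ → ∈⊤) X⊆cl[X]

  ∩-isFlat : IsFlat M X → IsFlat M Y → IsFlat M (X ∩ Y)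
  ∩-isFlat {X = X} {Y = Y} X-flat Y-flat = ⊆-antisym
    (∩-glb (subst (cl M (X ∩ Y) ⊆_) X-flat (cl-mono (p∩q⊆p X Y)))
           (subst (cl M (X ∩ Y) ⊆_) Y-flat (cl-mono (p∩q⊆q X Y))))
    X⊆cl[X]

  ⋂-isFlat : ∀ {I : Set} (f : I → Subset n) (is : List I) →
             (∀ i → IsFlat M (f i)) → IsFlat M (⋂ (map f is))
  ⋂-isFlat f []       _      = ⊤-isFlat
  ⋂-isFlat f (i ∷ is) f-flat = ∩-isFlat (f-flat i) (⋂-isFlat f is f-flat)

  modularDefect : Subset n → Subset n → ℕ
  modularDefect X Y = (r X + r Y) ∸ (r (X ∪ Y) + r (X ∩ Y))

  r-submod-defect : ∀ X Y → r (X ∪ Y) + r (X ∩ Y) + modularDefect X Y ≡ r X + r Y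
  r-submod-defect X Y = m+[n∸m]≡n (r-submod X Y)

  isModularPair⇔defect≡0 : IsFlat M X → IsFlat M Y → IsModularPair M X Y ⇔ modularDefect X Y ≡ 0
  isModularPair⇔defect≡0 {X = X} {Y = Y} X-flat Y-flat = mk⇔
    (λ (_ , _ , modular) → trans (cong (_∸ r∪+r∩) (trans modular (cong (_+ r (X ∩ Y)) r-cl))) (n∸n≡0 r∪+r∩))
    (λ defect≡0 → X-flat , Y-flat , (begin
      r X + r Y                                        ≡⟨ r-submod-defect X Y ⟨
      r (X ∪ Y) + r (X ∩ Y) + modularDefect X Y        ≡⟨ cong (r (X ∪ Y) + r (X ∩ Y) +_) defect≡0 ⟩
      r (X ∪ Y) + r (X ∩ Y) + 0                        ≡⟨ +-identityʳ _ ⟩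
      r (X ∪ Y) + r (X ∩ Y)                            ≡⟨ cong (_+ r (X ∩ Y)) r-cl ⟨
      r (cl M (X ∪ Y)) + r (X ∩ Y)                     ∎))
    where
    open ≡-Reasoning
    r∪+r∩ = r (X ∪ Y) + r (X ∩ Y)

  -- Nullity and cyclic sets

  ν : Subset n → ℕ
  ν X = ∣ X ∣ ∸ r X

  ν+r≡∣∣ : ν X + r X ≡ ∣ X ∣
  ν+r≡∣∣ {X = X} = m∸n+n≡m (r-bounded X)

  ν≡⇔ : ν X ≡ k ⇔ r X + k ≡ ∣ X ∣
  ν≡⇔ {X = X} {k = k} = mk⇔
    (λ ν≡k → trans (+-comm (r X) k) (trans (cong (_+ r X) (sym ν≡k)) ν+r≡∣∣))
    (λ r+k≡ → trans (cong (_∸ r X) (sym r+k≡)) (m+n∸m≡n (r X) k))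

  ν-supermod : ∀ X Y → ν X + ν Y ≤ ν (X ∪ Y) + ν (X ∩ Y)
  ν-supermod X Y = +-cancelʳ-≤ (r X + r Y) (ν X + ν Y) (ν (X ∪ Y) + ν (X ∩ Y)) (begin
    ν X + ν Y + (r X + r Y)                            ≡⟨ interchange (ν X) (ν Y) (r X) (r Y) ⟩
    (ν X + r X) + (ν Y + r Y)                          ≡⟨ cong₂ _+_ ν+r≡∣∣ ν+r≡∣∣ ⟩
    ∣ X ∣ + ∣ Y ∣                                      ≡⟨ ∣p∪q∣+∣p∩q∣≡∣p∣+∣q∣ X Y ⟨
    ∣ X ∪ Y ∣ + ∣ X ∩ Y ∣                              ≡⟨ cong₂ _+_ ν+r≡∣∣ ν+r≡∣∣ ⟨
    (ν (X ∪ Y) + r (X ∪ Y)) + (ν (X ∩ Y) + r (X ∩ Y))  ≡⟨ interchange (ν (X ∪ Y)) _ (ν (X ∩ Y)) _ ⟩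
    ν∪+ν∩ + (r (X ∪ Y) + r (X ∩ Y))                    ≤⟨ +-monoʳ-≤ ν∪+ν∩ (r-submod X Y) ⟩
    ν∪+ν∩ + (r X + r Y)                                ∎)
    where
    open ≤-Reasoning
    ν∪+ν∩ = ν (X ∪ Y) + ν (X ∩ Y)

  ν-mono : X ⊆ Y → ν X ≤ ν Y
  ν-mono {X = X} {Y = Y} X⊆Y = begin
    ν X                                ≤⟨ m≤m+n (ν X) _ ⟩
    ν X + ν (Y ─ X)                    ≤⟨ ν-supermod X (Y ─ X) ⟩
    ν (X ∪ (Y ─ X)) + ν (X ∩ (Y ─ X))  ≡⟨ cong₂ _+_ (cong ν (p∪[q─p]≡q X⊆Y)) ν[X∩[Y─X]]≡0 ⟩
    ν Y + 0                            ≡⟨ +-identityʳ (ν Y) ⟩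
    ν Y                                ∎
    where
    open ≤-Reasoning
    ν[X∩[Y─X]]≡0 : ν (X ∩ (Y ─ X)) ≡ 0
    ν[X∩[Y─X]]≡0 = trans (cong (_∸ r (X ∩ (Y ─ X))) (∣p∩[q─p]∣≡0 X Y)) (0∸n≡0 (r (X ∩ (Y ─ X))))

  r-∪⁅⁆≤suc : r (X ∪ ⁅ e ⁆) ≤ suc (r X)
  r-∪⁅⁆≤suc {X = X} {e = e} = begin
    r (X ∪ ⁅ e ⁆)                      ≤⟨ m≤m+n _ _ ⟩
    r (X ∪ ⁅ e ⁆) + r (X ∩ ⁅ e ⁆)      ≤⟨ r-submod X ⁅ e ⁆ ⟩
    r X + r ⁅ e ⁆                      ≤⟨ +-monoʳ-≤ (r X) (r-bounded ⁅ e ⁆) ⟩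
    r X + ∣ ⁅ e ⁆ ∣                    ≡⟨ cong (r X +_) (∣⁅x⁆∣≡1 e) ⟩
    r X + 1                            ≡⟨ +-comm (r X) 1 ⟩
    suc (r X)                          ∎
    where open ≤-Reasoning

  r[X-e]≡r[X]⇒suc-ν[X-e]≡ν[X] : e ∈ X → r (X - e) ≡ r X → suc (ν (X - e)) ≡ ν X
  r[X-e]≡r[X]⇒suc-ν[X-e]≡ν[X] {e = e} {X = X} e∈X r≡ = begin
    suc (∣ X - e ∣ ∸ r (X - e))  ≡⟨ +-∸-assoc 1 (r-bounded (X - e)) ⟨
    suc ∣ X - e ∣ ∸ r (X - e)    ≡⟨ cong₂ _∸_ (x∈p⇒suc∣p-x∣≡∣p∣ e∈X) r≡ ⟩
    ∣ X ∣ ∸ r X                  ∎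
    where open ≡-Reasoning

  -- The rank drops by exactly one, so both sides are ∣ X - e ∣ ∸ r (X - e).
  r[X-e]≢r[X]⇒ν[X-e]≡ν[X] : e ∈ X → r (X - e) ≢ r X → ν (X - e) ≡ ν X
  r[X-e]≢r[X]⇒ν[X-e]≡ν[X] {e = e} {X = X} e∈X r≢ =
    sym (cong₂ _∸_ (sym (x∈p⇒suc∣p-x∣≡∣p∣ e∈X)) r[X]≡suc)
    where
    X⊆[X-e]∪⁅e⁆ : X ⊆ (X - e) ∪ ⁅ e ⁆
    X⊆[X-e]∪⁅e⁆ {y} y∈X with y ≟ᶠ e
    ... | yes refl = x∈p∪q⁺ (inj₂ (x∈⁅x⁆ e))
    ... | no y≢e   = x∈p∪q⁺ (inj₁ (x∈p∧x≢y⇒x∈p-y y∈X y≢e))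
    r[X]≡suc : r X ≡ suc (r (X - e))
    r[X]≡suc = ≤-antisym (≤-trans (r-mono X⊆[X-e]∪⁅e⁆) r-∪⁅⁆≤suc)
                         (≤∧≢⇒< (r-mono (p─q⊆p X _)) r≢)

  cyclic⇒ν-< : IsCyclic M C → X ⊆ C → e ∈ C → e ∉ X → ν X < ν C
  cyclic⇒ν-< {C = C} {X = X} {e = e} C-cyclic X⊆C e∈C e∉X = begin-strict
    ν X              ≤⟨ ν-mono X⊆C-e ⟩
    ν (C - e)        <⟨ n<1+n _ ⟩
    suc (ν (C - e))  ≡⟨ r[X-e]≡r[X]⇒suc-ν[X-e]≡ν[X] e∈C (C-cyclic e e∈C) ⟩
    ν C              ∎
    where
    open ≤-Reasoning
    X⊆C-e : X ⊆ C - e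
    X⊆C-e x∈X = x∈p∧x≢y⇒x∈p-y (X⊆C x∈X) (λ x≡e → e∉X (subst (_∈ X) x≡e x∈X))

  cyclic-⊆-of-ν≤ : IsCyclic M C → X ⊆ C → ν C ≤ ν X → C ⊆ X
  cyclic-⊆-of-ν≤ {X = X} C-cyclic X⊆C ν≤ {e} e∈C with e ∈? X
  ... | yes e∈X = e∈X
  ... | no e∉X  = contradiction ν≤ (<⇒≱ (cyclic⇒ν-< C-cyclic X⊆C e∈C e∉X))

  private
    deletable? : ∀ X e → Dec (e ∈ X → r (X - e) ≡ r X)
    deletable? X e = e ∈? X →-dec r (X - e) ≟ r X

  cyclic⊎coloop : ∀ X → IsCyclic M X ⊎ ∃ λ e → e ∈ X × r (X - e) ≢ r X
  cyclic⊎coloop X with all? (deletable? X)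
  ... | yes X-cyclic = inj₁ X-cyclic
  ... | no ¬X-cyclic with ¬∀⟶∃¬ n _ (deletable? X) ¬X-cyclic
  ...   | e , ¬deletable with e ∈? X
  ...     | yes e∈X = inj₂ (e , e∈X , λ r≡ → ¬deletable (λ _ → r≡))
  ...     | no e∉X  = contradiction (λ e∈X → contradiction e∈X e∉X) ¬deletable

  cyclicCore : ∀ X → ∃ λ B → B ⊆ X × IsCyclic M B × ν B ≡ ν X
  cyclicCore X = go X (⊂-wellFounded X)
    where
    go : ∀ X → Acc _⊂_ X → ∃ λ B → B ⊆ X × IsCyclic M B × ν B ≡ ν X
    go X (acc rec) with cyclic⊎coloop X
    ... | inj₁ X-cyclic = X , id , X-cyclic , refl
    ... | inj₂ (e , e∈X , r≢) with go (X - e) (rec (x∈p⇒p-x⊂p e∈X))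
    ...   | B , B⊆X-e , B-cyclic , ν≡ =
      B , p─q⊆p X _ ∘ B⊆X-e , B-cyclic , trans ν≡ (r[X-e]≢r[X]⇒ν[X-e]≡ν[X] e∈X r≢)

  -- Blocks of the principal partition

  block⊆ : ∀ k → InPrincipalPartition M k D X → X ⊆ D
  block⊆ {D = D} _ (B , _ , _ , refl) = p─q⊆p D B

  block-complement : ∀ k → InPrincipalPartition M k D X → IsKFoldCircuit M (k ∸ 1) (D ─ X)
  block-complement {D = D} _ (B , B⊆D , B-circuit , refl) =
    subst (IsKFoldCircuit M _) (sym (p─[p─q]≡q B⊆D)) B-circuit

  -- If x ∉ C ∪ Y ⊆ D then ν (C ∪ Y) < ν D ≤ 1 + ν Y, so supermodularity forces ν C ≤ ν (C ∩ Y).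
  cyclic-⊆-ν-maximal : IsCyclic M D → IsCyclic M C → C ∪ Y ⊆ D → x ∈ D → x ∉ C ∪ Y →
                       ν D ≤ suc (ν Y) → C ⊆ Y
  cyclic-⊆-ν-maximal {C = C} {Y = Y} D-cyclic C-cyclic C∪Y⊆D x∈D x∉C∪Y νD≤ =
    p∩q⊆q C Y ∘ cyclic-⊆-of-ν≤ C-cyclic (p∩q⊆p C Y) (+-cancelʳ-≤ (ν Y) (ν C) (ν (C ∩ Y)) (begin
      ν C + ν Y              ≤⟨ ν-supermod C Y ⟩
      ν (C ∪ Y) + ν (C ∩ Y)  ≤⟨ +-monoˡ-≤ (ν (C ∩ Y)) ν[C∪Y]≤νY ⟩
      ν Y + ν (C ∩ Y)        ≡⟨ +-comm (ν Y) _ ⟩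
      ν (C ∩ Y) + ν Y        ∎))
    where
    open ≤-Reasoning
    ν[C∪Y]≤νY : ν (C ∪ Y) ≤ ν Y
    ν[C∪Y]≤νY = s≤s⁻¹ (≤-trans (cyclic⇒ν-< D-cyclic C∪Y⊆D x∈D x∉C∪Y) νD≤)

  blocks-disjoint : IsKFoldCircuit M (suc k) D →
                    InPrincipalPartition M (suc k) D X → InPrincipalPartition M (suc k) D Y →
                    x ∈ X → x ∈ Y → X ≡ Y
  blocks-disjoint {k = k} {D = D} {X = X} {Y = Y} {x = x} (D-cyclic , D-circuit) X-block Y-block x∈X x∈Y =
    begin
      X            ≡⟨ p─[p─q]≡q (block⊆ (suc k) X-block) ⟨
      D ─ (D ─ X)  ≡⟨ cong (D ─_) (⊆-antisym (complement-⊆ X-block Y-block x∈X x∈Y)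
                                             (complement-⊆ Y-block X-block x∈Y x∈X)) ⟩
      D ─ (D ─ Y)  ≡⟨ p─[p─q]≡q (block⊆ (suc k) Y-block) ⟩
      Y            ∎
    where
    open ≡-Reasoning
    complement-⊆ : ∀ {U V} → InPrincipalPartition M (suc k) D U → InPrincipalPartition M (suc k) D V →
                   x ∈ U → x ∈ V → D ─ U ⊆ D ─ V
    complement-⊆ {U} {V} U-block V-block x∈U x∈V =
      cyclic-⊆-ν-maximal D-cyclic (proj₁ (block-complement (suc k) U-block))
        (∪-lub (p─q⊆p D U) (p─q⊆p D V)) (block⊆ (suc k) U-block x∈U) x∉
        (≤-reflexive (trans νD≡ (cong suc (sym νV≡))))
      where
      x∉ : x ∉ (D ─ U) ∪ (D ─ V)
      x∉ x∈∪ with x∈p∪q⁻ (D ─ U) (D ─ V) x∈∪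
      ... | inj₁ x∈D─U = x∈p─q⇒x∉q x∈D─U x∈U
      ... | inj₂ x∈D─V = x∈p─q⇒x∉q x∈D─V x∈V
      νD≡ : ν D ≡ suc k
      νD≡ = Equivalence.from ν≡⇔ D-circuit
      νV≡ : ν (D ─ V) ≡ k
      νV≡ = Equivalence.from ν≡⇔ (proj₂ (block-complement (suc k) V-block))

  ∈-some-block : IsKFoldCircuit M (suc k) D → x ∈ D →
                 ∃ λ X → InPrincipalPartition M (suc k) D X × x ∈ X
  ∈-some-block {k = k} {D = D} {x = x} (D-cyclic , D-circuit) x∈D with cyclicCore (D - x)
  ... | B , B⊆D-x , B-cyclic , νB≡ =
    D ─ B , (B , p─q⊆p D _ ∘ B⊆D-x , (B-cyclic , Equivalence.to ν≡⇔ νB≡k) , refl) ,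
    x∈p∧x∉q⇒x∈p─q x∈D (λ x∈B → x∈p─q⇒x∉q (B⊆D-x x∈B) (x∈⁅x⁆ x))
    where
    open ≡-Reasoning
    νB≡k : ν B ≡ k
    νB≡k = suc-injective (begin
      suc (ν B)        ≡⟨ cong suc νB≡ ⟩
      suc (ν (D - x))  ≡⟨ r[X-e]≡r[X]⇒suc-ν[X-e]≡ν[X] x∈D (D-cyclic x x∈D) ⟩
      ν D              ≡⟨ Equivalence.from ν≡⇔ D-circuit ⟩
      suc k            ∎)

-- Prefix intersections

⋂-take-suc : ∀ {ℓ m} {I : Set} (f : I → Subset n) (g : Fin ℓ → I) (m<ℓ : m < ℓ) →
             ⋂ (map f (take (suc m) (tabulate g)))
               ≡ ⋂ (map f (take m (tabulate g))) ∩ f (g (fromℕ< m<ℓ))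
⋂-take-suc {ℓ = suc _} {m = zero}  f g _   = trans (∩-identityʳ _) (sym (∩-identityˡ _))
⋂-take-suc {ℓ = suc _} {m = suc m} f g m<ℓ =
  trans (cong (f (g Fin.zero) ∩_) (⋂-take-suc f (g ∘ Fin.suc) (s<s⁻¹ m<ℓ))) (sym (∩-assoc _ _ _))

∈⋂-take⇔ : ∀ {ℓ} {I : Set} (f : I → Subset n) (g : Fin ℓ → I) m →
           x ∈ ⋂ (map f (take m (tabulate g))) ⇔ (∀ j → toℕ j < m → x ∈ f (g j))
∈⋂-take⇔                f g zero    = mk⇔ (λ _ _ ()) (λ _ → ∈⊤)
∈⋂-take⇔ {ℓ = zero}     f g (suc m) = mk⇔ (λ _ ()) (λ _ → ∈⊤)
∈⋂-take⇔ {x = x} {ℓ = suc ℓ} f g (suc m) = mk⇔ to from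
  where
  tail⇔ : x ∈ ⋂ (map f (take m (tabulate (g ∘ Fin.suc)))) ⇔
          (∀ j → toℕ j < m → x ∈ f (g (Fin.suc j)))
  tail⇔ = ∈⋂-take⇔ f (g ∘ Fin.suc) m
  to : x ∈ ⋂ (map f (take (suc m) (tabulate g))) → ∀ j → toℕ j < suc m → x ∈ f (g j)
  to x∈⋂ Fin.zero    _         = proj₁ (x∈p∩q⁻ _ _ x∈⋂)
  to x∈⋂ (Fin.suc j) (s≤s j<m) = Equivalence.to tail⇔ (proj₂ (x∈p∩q⁻ _ _ x∈⋂)) j j<m
  from : (∀ j → toℕ j < suc m → x ∈ f (g j)) → x ∈ ⋂ (map f (take (suc m) (tabulate g)))
  from x∈all = x∈p∩q⁺ ( x∈all Fin.zero (s≤s z≤n)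
                      , Equivalence.from tail⇔ (λ j j<m → x∈all (Fin.suc j) (s≤s j<m)))

m+n≡0⇔ : ∀ {m n} → m + n ≡ 0 ⇔ (m ≡ 0 × n ≡ 0)
m+n≡0⇔ {m} = mk⇔ (λ m+n≡0 → m+n≡0⇒m≡0 m m+n≡0 , m+n≡0⇒n≡0 m m+n≡0) (λ { (refl , refl) → refl })

m+n≡o⇒n≡0⇔m≡o : ∀ {m n o} → m + n ≡ o → (n ≡ 0 ⇔ m ≡ o)
m+n≡o⇒n≡0⇔m≡o {m} {n} m+n≡o = mk⇔
  (λ n≡0 → trans (sym (+-identityʳ m)) (trans (cong (m +_) (sym n≡0)) m+n≡o))
  (λ m≡o → +-cancelˡ-≡ m n 0 (trans m+n≡o (sym (trans (+-identityʳ m) m≡o))))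

rankCount-step-arithmetic : ∀ {rF rQ rI rD k s δ m g g′ c d} →
                  rD + rI + δ ≡ rF + rQ → rQ + k ≡ c → g + c ≡ d + g′ → rD + suc k ≡ d →
                  rF + suc k + s ≡ m + g → rI + suc k + (s + δ) ≡ suc m + g′
rankCount-step-arithmetic {rF} {rQ} {rI} {rD} {k} {s} {δ} {m} {g} {g′} defect refl card refl count =
  +-cancelʳ-≡ (rD + k) (rI + suc k + (s + δ)) (suc m + g′) (begin
    rI + suc k + (s + δ) + (rD + k)  ≡⟨ solve (rI ∷ rD ∷ k ∷ s ∷ δ ∷ []) ⟩
    rD + rI + δ + (suc k + s + k)    ≡⟨ cong (_+ (suc k + s + k)) defect ⟩
    rF + rQ + (suc k + s + k)        ≡⟨ solve (rF ∷ rQ ∷ k ∷ s ∷ []) ⟩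
    rF + suc k + s + (rQ + k)        ≡⟨ cong (_+ (rQ + k)) count ⟩
    m + g + (rQ + k)                 ≡⟨ +-assoc m g (rQ + k) ⟩
    m + (g + (rQ + k))               ≡⟨ cong (m +_) card ⟩
    m + (rD + suc k + g′)            ≡⟨ solve (m ∷ rD ∷ k ∷ g′ ∷ []) ⟩
    suc m + g′ + (rD + k)            ∎)
  where open ≡-Reasoning

module PrefixIntersections
  {n : ℕ} (M : Matroid n) (k : ℕ) (D : Subset n) (D-circuit : IsKFoldCircuit M (suc k) D)
  (ℓ : ℕ) (A : Fin ℓ → Subset n) (A-injective : Injective _≡_ _≡_ A)
  (A-blocks : ∀ X → InPrincipalPartition M (suc k) D X ⇔ ∃ (λ i → A i ≡ X))
  where

  open Matroid M

  private
    variable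
      m : ℕ
      i j : Fin ℓ

  C : Fin ℓ → Subset n
  C i = D ─ A i

  A-block : ∀ i → InPrincipalPartition M (suc k) D (A i)
  A-block i = Equivalence.from (A-blocks (A i)) (i , refl)

  A⊆D : A i ⊆ D
  A⊆D {i} = block⊆ M (suc k) (A-block i)

  C-circuit : ∀ i → IsKFoldCircuit M k (C i)
  C-circuit i = block-complement M (suc k) (A-block i)

  A-disjoint : x ∈ A i → x ∈ A j → i ≡ j
  A-disjoint {i = i} {j = j} x∈Ai x∈Aj =
    A-injective (blocks-disjoint M D-circuit (A-block i) (A-block j) x∈Ai x∈Aj)

  A-cover : x ∈ D → ∃ λ j → x ∈ A j
  A-cover x∈D with ∈-some-block M D-circuit x∈D
  ... | X , X-block , x∈X with Equivalence.to (A-blocks X) X-block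
  ...   | j , refl = j , x∈X

  F : ℕ → Subset n
  F = prefixInter M D A

  G : ℕ → Subset n
  G m = D ∩ ⋂ (map C (take m (allFin ℓ)))

  F-suc : (m<ℓ : m < ℓ) → F (suc m) ≡ F m ∩ cl M (C (fromℕ< m<ℓ))
  F-suc = ⋂-take-suc (cl M ∘ C) id

  G-suc : (m<ℓ : m < ℓ) → G (suc m) ≡ G m ∩ C (fromℕ< m<ℓ)
  G-suc m<ℓ = trans (cong (D ∩_) (⋂-take-suc C id m<ℓ)) (sym (∩-assoc D _ _))

  F-isFlat : ∀ m → IsFlat M (F m)
  F-isFlat m = ⋂-isFlat M (cl M ∘ C) (take m (allFin ℓ)) (λ _ → cl-isFlat M)

  G⊆F : G m ⊆ F m
  G⊆F {m} x∈G = Equivalence.from (∈⋂-take⇔ (cl M ∘ C) id m)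
    (λ j j<m → X⊆cl[X] M (Equivalence.to (∈⋂-take⇔ C id m) (proj₂ (x∈p∩q⁻ D _ x∈G)) j j<m))

  A⊆G : m ≤ toℕ j → A j ⊆ G m
  A⊆G {m} {j} m≤j x∈Aj = x∈p∩q⁺ (A⊆D x∈Aj , Equivalence.from (∈⋂-take⇔ C id m) x∈C)
    where
    x∈C : ∀ i → toℕ i < m → _ ∈ C i
    x∈C i i<m = x∈p∧x∉q⇒x∈p─q (A⊆D x∈Aj)
      (λ x∈Ai → <⇒≢ (<-≤-trans i<m m≤j) (cong toℕ (A-disjoint x∈Ai x∈Aj)))

  G-empty : Empty (G ℓ)
  G-empty (x , x∈G) with x∈p∩q⁻ D _ x∈G
  ... | x∈D , x∈⋂ with A-cover x∈D
  ...   | j , x∈Aj = x∈p─q⇒x∉q (Equivalence.to (∈⋂-take⇔ C id ℓ) x∈⋂ j (toℕ<n j)) x∈Aj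

  G∪C≡D : (m<ℓ : m < ℓ) → G m ∪ C (fromℕ< m<ℓ) ≡ D
  G∪C≡D {m} m<ℓ = ⊆-antisym (∪-lub (p∩q⊆p D _) (p─q⊆p D _)) D⊆
    where
    j₀ = fromℕ< m<ℓ
    D⊆ : D ⊆ G m ∪ C j₀
    D⊆ {x} x∈D with x ∈? A j₀
    ... | yes x∈A = x∈p∪q⁺ (inj₁ (A⊆G (≤-reflexive (sym (toℕ-fromℕ< m<ℓ))) x∈A))
    ... | no x∉A  = x∈p∪q⁺ (inj₂ (x∈p∧x∉q⇒x∈p─q x∈D x∉A))

  -- Fails for F 0 = ⊤, which need not lie in cl D.
  r[F∪cl[C]]≡r[D] : (m<ℓ : suc m < ℓ) → r (F (suc m) ∪ cl M (C (fromℕ< m<ℓ))) ≡ r D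
  r[F∪cl[C]]≡r[D] {m} m<ℓ = ≤-antisym
    (≤-trans (r-mono (∪-lub F⊆cl[D] (cl-mono M (p─q⊆p D _)))) (≤-reflexive (r-cl M)))
    (r-mono (subst (_⊆ F (suc m) ∪ Q) (G∪C≡D m<ℓ)
       (∪-lub (p⊆p∪q Q ∘ G⊆F {suc m}) (q⊆p∪q (F (suc m)) Q ∘ X⊆cl[X] M))))
    where
    Q = cl M (C (fromℕ< m<ℓ))
    F⊆cl[D] : F (suc m) ⊆ cl M D
    F⊆cl[D] x∈F = cl-mono M (p─q⊆p D _) (p∩q⊆q (F m) _ (subst (_ ∈_) (F-suc (<⇒≤ m<ℓ)) x∈F))

  ModularAt : Fin ℓ → Set
  ModularAt j = IsModularPair M (F (toℕ j)) (cl M (C j))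

  ModularBelow : ℕ → Set
  ModularBelow m = ∀ j → 1 ≤ toℕ j → toℕ j < m → ModularAt j

  modularBelow-suc : (m<ℓ : suc m < ℓ) →
    ModularBelow (suc (suc m)) ⇔
    (ModularBelow (suc m) × IsModularPair M (F (suc m)) (cl M (C (fromℕ< m<ℓ))))
  modularBelow-suc {m} m<ℓ = mk⇔
    (λ all → (λ j 1≤j j<m → all j 1≤j (m<n⇒m<1+n j<m)) ,
             subst at (toℕ-fromℕ< m<ℓ) (all j₀ (subst (1 ≤_) (sym (toℕ-fromℕ< m<ℓ)) (s≤s z≤n))
                                                (subst (_< suc (suc m)) (sym (toℕ-fromℕ< m<ℓ)) ≤-refl)))
    (λ (below , modular) j 1≤j j<m →
       last-or-below below modular j 1≤j (m≤n⇒m<n∨m≡n (s≤s⁻¹ j<m)))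
    where
    j₀ = fromℕ< m<ℓ
    at : ℕ → Set
    at t = IsModularPair M (F t) (cl M (C j₀))
    last-or-below : ModularBelow (suc m) → at (suc m) →
                    ∀ j → 1 ≤ toℕ j → toℕ j < suc m ⊎ toℕ j ≡ suc m → ModularAt j
    last-or-below below _       j 1≤j (inj₁ j<m) = below j 1≤j j<m
    last-or-below _     modular j _   (inj₂ j≡m) with toℕ-injective (trans j≡m (sym (toℕ-fromℕ< m<ℓ)))
    ... | refl = subst at (sym (toℕ-fromℕ< m<ℓ)) modular

  -- The slack s is the sum of the modular defects of the pairs met so far.
  RankCount : ℕ → Set
  RankCount m = Σ[ s ∈ ℕ ] (r (F m) + suc k + s ≡ m + ∣ G m ∣) × (s ≡ 0 ⇔ ModularBelow m)

  rankCount : ∀ m → suc m ≤ ℓ → RankCount (suc m)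
  rankCount zero 0<ℓ = 0 , base , mk⇔ (λ _ j 1≤j j<1 → contradiction 1≤j (<⇒≱ j<1)) (λ _ → refl)
    where
    j₀ = fromℕ< 0<ℓ
    F₁≡ : F 1 ≡ cl M (C j₀)
    F₁≡ = trans (F-suc 0<ℓ) (∩-identityˡ _)
    G₁≡ : G 1 ≡ C j₀
    G₁≡ = trans (G-suc 0<ℓ) (⊆-antisym (p∩q⊆q _ _) (∩-glb (∩-glb (p─q⊆p D _) (λ _ → ∈⊤)) id))
    base : r (F 1) + suc k + 0 ≡ 1 + ∣ G 1 ∣
    base = begin
      r (F 1) + suc k + 0      ≡⟨ +-identityʳ _ ⟩
      r (F 1) + suc k          ≡⟨ cong (λ Z → r Z + suc k) F₁≡ ⟩
      r (cl M (C j₀)) + suc k  ≡⟨ cong (_+ suc k) (r-cl M) ⟩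
      r (C j₀) + suc k         ≡⟨ +-suc (r (C j₀)) k ⟩
      suc (r (C j₀) + k)       ≡⟨ cong suc (proj₂ (C-circuit j₀)) ⟩
      suc ∣ C j₀ ∣             ≡⟨ cong (suc ∘ ∣_∣) G₁≡ ⟨
      1 + ∣ G 1 ∣              ∎
      where open ≡-Reasoning
  rankCount (suc m) m<ℓ with rankCount m (<⇒≤ m<ℓ)
  ... | s , count , s≡0⇔ = s + δ , count′ , s+δ≡0⇔
    where
    j₀ = fromℕ< m<ℓ
    Q = cl M (C j₀)
    δ = modularDefect M (F (suc m)) Q
    δ≡0⇔ : δ ≡ 0 ⇔ IsModularPair M (F (suc m)) Q
    δ≡0⇔ = ⇔-sym (isModularPair⇔defect≡0 M (F-isFlat (suc m)) (cl-isFlat M))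
    defect : r D + r (F (suc (suc m))) + δ ≡ r (F (suc m)) + r Q
    defect = trans (cong₂ (λ a b → a + b + δ) (sym (r[F∪cl[C]]≡r[D] m<ℓ)) (cong r (F-suc m<ℓ)))
                   (r-submod-defect M (F (suc m)) Q)
    card : ∣ G (suc m) ∣ + ∣ C j₀ ∣ ≡ ∣ D ∣ + ∣ G (suc (suc m)) ∣
    card = trans (sym (∣p∪q∣+∣p∩q∣≡∣p∣+∣q∣ (G (suc m)) (C j₀)))
                 (cong₂ _+_ (cong ∣_∣ (G∪C≡D m<ℓ)) (cong ∣_∣ (sym (G-suc m<ℓ))))
    count′ : r (F (suc (suc m))) + suc k + (s + δ) ≡ suc (suc m) + ∣ G (suc (suc m)) ∣
    count′ = rankCount-step-arithmetic defect (trans (cong (_+ k) (r-cl M)) (proj₂ (C-circuit j₀))) card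
                             (proj₂ D-circuit) count
    s+δ≡0⇔ : s + δ ≡ 0 ⇔ ModularBelow (suc (suc m))
    s+δ≡0⇔ = ⇔-sym (modularBelow-suc m<ℓ) ⇔-∘ ((s≡0⇔ ×-⇔ δ≡0⇔) ⇔-∘ m+n≡0⇔)

  D-nonempty : Nonempty D
  D-nonempty with nonempty? D
  ... | yes D≠∅ = D≠∅
  ... | no D=∅ = contradiction (trans (proj₂ D-circuit) (Empty⇒∣p∣≡0 D=∅)) (m+1+n≢0 (r D))

  rankCount-ℓ : RankCount ℓ
  rankCount-ℓ = subst RankCount (suc-pred ℓ) (rankCount (pred ℓ) (≤-reflexive (suc-pred ℓ)))
    where instance _ = nonZeroIndex (proj₁ (A-cover (proj₂ D-nonempty)))

  theorem : (r (F ℓ) + suc k ≤ ℓ) × (r (F ℓ) + suc k ≡ ℓ ⇔ (∀ j → 1 ≤ toℕ j → ModularAt j))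
  theorem with rankCount-ℓ
  ... | s , count , s≡0⇔ =
    ≤-trans (m≤m+n _ s) (≤-reflexive count′) ,
    all-modular ⇔-∘ (s≡0⇔ ⇔-∘ ⇔-sym (m+n≡o⇒n≡0⇔m≡o count′))
    where
    count′ : r (F ℓ) + suc k + s ≡ ℓ
    count′ = trans count (trans (cong (ℓ +_) (Empty⇒∣p∣≡0 G-empty)) (+-identityʳ ℓ))
    all-modular : ModularBelow ℓ ⇔ (∀ j → 1 ≤ toℕ j → ModularAt j)
    all-modular = mk⇔ (λ below j 1≤j → below j 1≤j (toℕ<n j)) (λ all j 1≤j _ → all j 1≤j)

mainTheorem2 : {n : ℕ} (M : Matroid n) (k : ℕ) (D : Subset n) →
    1 ≤ k → IsKFoldCircuit M k D →
    (ℓ : ℕ) (A : Fin ℓ → Subset n) → Injective _≡_ _≡_ A →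
    (∀ X → InPrincipalPartition M k D X ⇔ ∃ (λ i → A i ≡ X)) →
    (Matroid.r M (prefixInter M D A ℓ) + k ≤ ℓ)
    × (Matroid.r M (prefixInter M D A ℓ) + k ≡ ℓ
        ⇔ (∀ (j : Fin ℓ) → 1 ≤ toℕ j →
             IsModularPair M (prefixInter M D A (toℕ j)) (cl M (D ─ A j))))
mainTheorem2 M (suc k) D _ D-circuit ℓ A A-injective A-blocks =
  PrefixIntersections.theorem M k D D-circuit ℓ A A-injective A-blocks
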